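{- For every $\beta<\varepsilon_\omega$, every $\alpha<\beta$ and every natural number $n>1$: if $\mathrm{psn}(\alpha)<n$ then $\beta\Rightarrow_n\alpha$.
   Context: $\varepsilon_{ -1}=\omega$; $\varepsilon_m$ ($m\ge0$) is the $m$-th epsilon number. $\mathrm{tow}_0(\xi)=1$, $\mathrm{tow}_{n+1}(\xi)=\xi^{\mathrm{tow}_n(\xi)}$. $l(\alpha)=\min\{n:\alpha<\varepsilon_n\}$, $h(\alpha)=\min\{n:\alpha<\mathrm{tow}_n(\varepsilon_{l(\alpha)-1})\}$. Normal form: $\alpha=\varepsilon_j^{\alpha_0}\xi_0+\dots+\varepsilon_j^{\alpha_s}\xi_s$ with $j=l(\alpha)-1$, $\alpha_0>\dots>\alpha_s$, $0<\xi_i<\varepsilon_j$. Pseudonorm: $\mathrm{psn}(\alpha)=\alpha$ for $\alpha<\omega$, else $\max\{h(\alpha),\mathrm{psn}(\alpha_i),\mathrm{psn}(\xi_i)\}$. $(\gamma+1)[n]=\gamma$, and for limits $\lambda$ written to base $\varepsilon_j$: $\omega[n]=n$; $\varepsilon_j[n]=\mathrm{tow}_n(\varepsilon_{j-1})$ ($j\ge0$); $(\varepsilon_j^{\gamma+1})[n]=\varepsilon_j^{\gamma}\varepsilon_j[n]$; $(\varepsilon_j^{\psi})[n]=\varepsilon_j^{\psi[n]}$ ($\psi$ limit); $(\varepsilon_j^{\psi}(\gamma+1))[n]=\varepsilon_j^{\psi}\gamma+\varepsilon_j^{\psi}[n]$; $(\varepsilon_j^{\psi}\xi)[n]=\varepsilon_j^{\psi}\xi[n]$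 ($\xi$ limit); for a sum of several normal-form terms only the last term is replaced. $\beta\Rightarrow_n\alpha$ means there is a finite sequence $\alpha_0=\beta,\alpha_1,\dots,\alpha_k=\alpha$ with $\alpha_{i+1}=\alpha_i[n]$ for all $i<k$. -}

module Defs where

open import Data.Nat using (ℕ; zero; suc; _<_; _⊔_)
open import Data.Bool using (Bool; true; false; if_then_else_)
open import Data.Unit using (⊤)
open import Data.Empty using (⊥)
open import Data.Product using (_×_; ∃)
open import Relation.Binary.PropositionalEquality using (_≡_)
open import Relation.Nullary using (¬_)

-- Ordinal notations for ordinals below ε_ω.
--
-- Convention: ε_{-1} = ω.  The constructor  ep k ts  denotes an ordinal
-- α with  l(α) = k  (i.e. ε_{k-1} ≤ α < ε_k), written in normal form to
-- base ε_{k-1}: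
--     ep k (⟨ α₀ , ξ₀ ⟩∷ ⟨ α₁ , ξ₁ ⟩∷ … ⟨ αₛ , ξₛ ⟩∷ [])
--       =  ε_{k-1}^{α₀}·ξ₀ + … + ε_{k-1}^{αₛ}·ξₛ .
-- fin m denotes the natural number m (the ordinals below ω).

mutual
  data Ord : Set where
    fin : ℕ → Ord
    ep  : ℕ → Terms → Ord

  data Terms : Set where
    []      : Terms
    ⟨_,_⟩∷_ : Ord → Ord → Terms → Terms

-- Comparison of notations (correct on well-formed notations).

data Cmp : Set where
  LT EQ GT : Cmp

cmpℕ : ℕ → ℕ → Cmp
cmpℕ zero    zero    = EQ
cmpℕ zero    (suc _) = LT
cmpℕ (suc _) zero    = GT
cmpℕ (suc a) (suc b) = cmpℕ a b

lex : Cmp → Cmp → Cmp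
lex LT _ = LT
lex EQ c = c
lex GT _ = GT

mutual
  cmp : Ord → Ord → Cmp
  cmp (fin a)   (fin b)   = cmpℕ a b
  cmp (fin _)   (ep _ _)  = LT
  cmp (ep _ _)  (fin _)   = GT
  cmp (ep k ts) (ep k' us) = lex (cmpℕ k k') (cmpT ts us)

  cmpT : Terms → Terms → Cmp
  cmpT [] [] = EQ
  cmpT [] (⟨ _ , _ ⟩∷ _) = LT
  cmpT (⟨ _ , _ ⟩∷ _) [] = GT
  cmpT (⟨ a , x ⟩∷ ts) (⟨ b , y ⟩∷ us) = lex (cmp a b) (lex (cmp x y) (cmpT ts us))

_<ₒ_ : Ord → Ord → Set
α <ₒ β = cmp α β ≡ LT

-- Below k α  :  α < ε_{k-1}   (for well-formed α)
Below : ℕ → Ord → Set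
Below k (fin _)   = ⊤
Below k (ep k' _) = k' < k

FirstExpBelow : Terms → Ord → Set
FirstExpBelow []             a = ⊤
FirstExpBelow (⟨ b , _ ⟩∷ _) a = b <ₒ a

FirstExpPos : Terms → Set
FirstExpPos []             = ⊥
FirstExpPos (⟨ a , _ ⟩∷ _) = fin 0 <ₒ a

mutual
  WF : Ord → Set
  WF (fin _)   = ⊤
  WF (ep k ts) = FirstExpPos ts × WFT k ts

  WFT : ℕ → Terms → Set
  WFT k [] = ⊤
  WFT k (⟨ a , x ⟩∷ ts) =
    WF a × WF x × Below (suc k) a × Below k x × ¬ (x ≡ fin 0)
    × FirstExpBelow ts a × WFT k ts

-- Towers:  tow k n  denotes  tow_n(ε_{k-1}).

tow : ℕ → ℕ → Ord
tow k zero    = fin 1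
tow k (suc n) = ep k (⟨ tow k n , fin 1 ⟩∷ [])

IsMin : (ℕ → Set) → ℕ → Set
IsMin P m = P m × (∀ m' → m' < m → ¬ P m')

-- For α = ep k ts we have l(α) = k, so
-- h(α) = min { n : α < tow_n(ε_{k-1}) }.
IsH : Ord → ℕ → Set
IsH (fin _)   m = ⊥       -- h is only used for α ≥ ω
IsH (ep k ts) m = IsMin (λ n → ep k ts <ₒ tow k n) m

mutual
  data Psn : Ord → ℕ → Set where
    psn-fin : ∀ {m} → Psn (fin m) m
    psn-ep  : ∀ {k ts h q} → IsH (ep k ts) h → PsnT ts q →
              Psn (ep k ts) (h ⊔ q)

  data PsnT : Terms → ℕ → Set where
    psnT-[] : PsnT [] 0
    psnT-∷  : ∀ {a x ts pa px pt} → Psn a pa → Psn x px → PsnT ts pt →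
              PsnT (⟨ a , x ⟩∷ ts) (pa ⊔ (px ⊔ pt))

-- ε_{k-1}[n] :  ω[n] = n,  ε_j[n] = tow_n(ε_{j-1})
baseFS : ℕ → ℕ → Ord
baseFS zero    n = fin n
baseFS (suc k) n = tow k n

mutual
  isSucc : Ord → Bool
  isSucc (fin zero)    = false
  isSucc (fin (suc _)) = true
  isSucc (ep _ ts)     = isSuccT ts

  isSuccT : Terms → Bool
  isSuccT [] = false
  isSuccT (⟨ fin zero , ξ ⟩∷ []) = isSucc ξ
  isSuccT (⟨ fin (suc _) , _ ⟩∷ []) = false
  isSuccT (⟨ ep _ _ , _ ⟩∷ []) = false
  isSuccT (⟨ _ , _ ⟩∷ (⟨ a , x ⟩∷ ts)) = isSuccT (⟨ a , x ⟩∷ ts)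

consNZ : Ord → Ord → Terms → Terms
consNZ a (fin zero) ts = ts
consNZ a x          ts = ⟨ a , x ⟩∷ ts

norm : ℕ → Terms → Ord
norm k [] = fin 0
norm k (⟨ fin zero , ξ ⟩∷ _) = ξ
norm k ts = ep k ts

mutual
  _[_] : Ord → ℕ → Ord
  fin zero    [ n ] = fin zero
  fin (suc m) [ n ] = fin m
  ep k ts     [ n ] = norm k (fsT k ts n)

  fsT : ℕ → Terms → ℕ → Terms
  fsT k [] n = []
  fsT k (⟨ ψ , ξ ⟩∷ []) n = lastFS k ψ ξ n
  fsT k (⟨ a , x ⟩∷ (⟨ b , y ⟩∷ ts)) n = ⟨ a , x ⟩∷ fsT k (⟨ b , y ⟩∷ ts) n

  lastFS : ℕ → Ord → Ord → ℕ → Terms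
  lastFS k (fin zero) ξ n = consNZ (fin zero) (ξ [ n ]) []
  lastFS k ψ ξ n =
    if isSucc ξ
    then consNZ ψ (ξ [ n ]) (powFS k ψ n)
    else consNZ ψ (ξ [ n ]) []

  -- (ε_{k-1}^ψ)[n] for ψ > 0
  powFS : ℕ → Ord → ℕ → Terms
  powFS k ψ n =
    if isSucc ψ
    then consNZ (ψ [ n ]) (baseFS k n) []
    else ⟨ ψ [ n ] , fin 1 ⟩∷ []

iterFS : ℕ → ℕ → Ord → Ord
iterFS n zero    β = β
iterFS n (suc i) β = iterFS n i (β [ n ])

_⇒[_]_ : Ord → ℕ → Ord → Set
β ⇒[ n ] α = ∃ λ i → iterFS n i β ≡ α

module Submission where

open import Defs
open import Data.Nat using (ℕ; zero; suc; _<_; _≤_; _+_; z≤n; s≤s)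
open import Data.Nat.Properties
  using (<-trans; <⇒≤; <-≤-trans; ≤-refl; n<1+n; m<1+n⇒m<n∨m≡n; m⊔n<o⇒m<o; m⊔n<o⇒n<o)
open import Data.Bool using (Bool; true; false; if_then_else_)
open import Data.Unit using (⊤; tt)
open import Data.Empty using (⊥; ⊥-elim)
open import Data.Product using (_×_; _,_; ∃; proj₁; proj₂)
open import Data.Sum using (_⊎_; inj₁; inj₂)
open import Relation.Binary.PropositionalEquality
  using (_≡_; refl; sym; trans; cong; cong₂; subst)
open import Relation.Nullary using (¬_)

-- Two facts about a single step γ ↦ γ[n] (valid for every n > 0) drive the
-- proof:
--   * descent (module Descent): γ[n] is again a well-formed notation, and
--     γ[n] < γ whenever γ ≠ 0;
--   * the step bound (module StepBound): if α < γ and psn(α) < n, then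
--     α ≤ γ[n], with equality only when γ is a successor.  Its core is
--     below-baseFS: x < ε_{k-1} and psn(x) < n give x < ε_{k-1}[n].
-- Hence α stays ≤ every term of the sequence β, β[n], β[n][n], … until it
-- is hit, provided the sequence reaches 0.  That it does is shown in module
-- Termination, by stepping away the terms of a normal form from the last
-- one on.

cmpℕ-refl : ∀ m → cmpℕ m m ≡ EQ
cmpℕ-refl zero    = refl
cmpℕ-refl (suc m) = cmpℕ-refl m

cmpℕ-EQ : ∀ {a b} → cmpℕ a b ≡ EQ → a ≡ b
cmpℕ-EQ {zero}  {zero}  _ = refl
cmpℕ-EQ {suc a} {suc b} e = cong suc (cmpℕ-EQ e)

cmpℕ-< : ∀ {a b} → a < b → cmpℕ a b ≡ LT
cmpℕ-< {zero}  {suc b} _       = refl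
cmpℕ-< {suc a} {suc b} (s≤s p) = cmpℕ-< p

cmpℕ-> : ∀ {a b} → b < a → cmpℕ a b ≡ GT
cmpℕ-> {suc a} {zero}  _       = refl
cmpℕ-> {suc a} {suc b} (s≤s p) = cmpℕ-> p

cmpℕ-LT : ∀ {a b} → cmpℕ a b ≡ LT → a < b
cmpℕ-LT {zero}  {suc b} _ = s≤s z≤n
cmpℕ-LT {suc a} {suc b} p = s≤s (cmpℕ-LT p)

cmpℕ-trans : ∀ a b c → cmpℕ a b ≡ LT → cmpℕ b c ≡ LT → cmpℕ a c ≡ LT
cmpℕ-trans a b c p q = cmpℕ-< (<-trans (cmpℕ-LT {a} {b} p) (cmpℕ-LT {b} {c} q))

lex-LT : ∀ {c d} → c ≡ LT → lex c d ≡ LT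
lex-LT refl = refl

lex-EQ : ∀ {c d} → c ≡ EQ → lex c d ≡ d
lex-EQ refl = refl

lex-EQʳ : ∀ c → lex c EQ ≡ c
lex-EQʳ LT = refl
lex-EQʳ EQ = refl
lex-EQʳ GT = refl

lex-EQ-inv : ∀ {c d} → lex c d ≡ EQ → c ≡ EQ × d ≡ EQ
lex-EQ-inv {EQ} e = refl , e

lex-LT-inv : ∀ c {d} → lex c d ≡ LT → c ≡ LT ⊎ (c ≡ EQ × d ≡ LT)
lex-LT-inv LT _ = inj₁ refl
lex-LT-inv EQ e = inj₂ (refl , e)

lex-trans : ∀ {A : Set} (c : A → A → Cmp) → (∀ {a b} → c a b ≡ EQ → a ≡ b) →
            ∀ a b d → (c a b ≡ LT → c b d ≡ LT → c a d ≡ LT) →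
            ∀ {r s t} → (r ≡ LT → s ≡ LT → t ≡ LT) →
            lex (c a b) r ≡ LT → lex (c b d) s ≡ LT → lex (c a d) t ≡ LT
lex-trans c faithful a b d trans₁ trans₂ p q
  with lex-LT-inv (c a b) p | lex-LT-inv (c b d) q
... | inj₁ ab       | inj₁ bd       = lex-LT (trans₁ ab bd)
... | inj₁ ab       | inj₂ (bd , _) = lex-LT (subst (λ z → c a z ≡ LT) (faithful bd) ab)
... | inj₂ (ab , _) | inj₁ bd       = lex-LT (subst (λ z → c z d ≡ LT) (sym (faithful ab)) bd)
... | inj₂ (ab , r) | inj₂ (bd , s) with faithful ab | faithful bd
...   | refl | refl = trans (lex-EQ ab) (trans₂ r s)

mutual
  cmp-refl : ∀ a → cmp a a ≡ EQ
  cmp-refl (fin m)  = cmpℕ-refl m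
  cmp-refl (ep k T) = trans (lex-EQ (cmpℕ-refl k)) (cmpT-refl T)

  cmpT-refl : ∀ T → cmpT T T ≡ EQ
  cmpT-refl []             = refl
  cmpT-refl (⟨ a , x ⟩∷ T) =
    trans (lex-EQ (cmp-refl a)) (trans (lex-EQ (cmp-refl x)) (cmpT-refl T))

cmp-≡ : ∀ {a b} → a ≡ b → cmp a b ≡ EQ
cmp-≡ {a} refl = cmp-refl a

cons-≡ : ∀ {a b x y T U} → a ≡ b → x ≡ y → T ≡ U → (⟨ a , x ⟩∷ T) ≡ (⟨ b , y ⟩∷ U)
cons-≡ refl refl refl = refl

mutual
  cmp-EQ : ∀ {a b} → cmp a b ≡ EQ → a ≡ b
  cmp-EQ {fin a}  {fin b}    e = cong fin (cmpℕ-EQ e)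
  cmp-EQ {ep k T} {ep k' T'} e with lex-EQ-inv {cmpℕ k k'} e
  ... | e₁ , e₂ = cong₂ ep (cmpℕ-EQ e₁) (cmpT-EQ e₂)

  cmpT-EQ : ∀ {T U} → cmpT T U ≡ EQ → T ≡ U
  cmpT-EQ {[]}           {[]}           e = refl
  cmpT-EQ {⟨ a , x ⟩∷ T} {⟨ b , y ⟩∷ U} e with lex-EQ-inv {cmp a b} e
  ... | e₁ , e₂ with lex-EQ-inv {cmp x y} e₂
  ...   | e₃ , e₄ = cons-≡ (cmp-EQ e₁) (cmp-EQ e₃) (cmpT-EQ e₄)

mutual
  cmp-trans : ∀ a b c → cmp a b ≡ LT → cmp b c ≡ LT → cmp a c ≡ LT
  cmp-trans (fin a)  (fin b)    (fin c)     p q = cmpℕ-trans a b c p q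
  cmp-trans (fin a)  (fin b)    (ep _ _)    p q = refl
  cmp-trans (fin a)  (ep _ _)   (ep _ _)    p q = refl
  cmp-trans (ep k T) (ep k' T') (ep k'' T'') p q =
    lex-trans cmpℕ cmpℕ-EQ k k' k'' (cmpℕ-trans k k' k'') (cmpT-trans T T' T'') p q

  cmpT-trans : ∀ T U V → cmpT T U ≡ LT → cmpT U V ≡ LT → cmpT T V ≡ LT
  cmpT-trans [] (⟨ _ , _ ⟩∷ _) (⟨ _ , _ ⟩∷ _) p q = refl
  cmpT-trans (⟨ a , x ⟩∷ T) (⟨ b , y ⟩∷ U) (⟨ c , z ⟩∷ V) p q =
    lex-trans cmp cmp-EQ a b c (cmp-trans a b c)
      (lex-trans cmp cmp-EQ x y z (cmp-trans x y z) (cmpT-trans T U V)) p q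

<ₒ-trans : ∀ {a b c} → a <ₒ b → b <ₒ c → a <ₒ c
<ₒ-trans {a} {b} {c} = cmp-trans a b c

≮0 : ∀ a → ¬ (a <ₒ fin 0)
≮0 (fin zero)    ()
≮0 (fin (suc m)) ()
≮0 (ep _ _)      ()

-- Nonzero a : a is not the notation 0; unlike ¬ a ≡ fin 0 it computes,
-- which is what makes norm and consNZ reduce.
Nonzero : Ord → Set
Nonzero (fin zero)    = ⊥
Nonzero (fin (suc _)) = ⊤
Nonzero (ep _ _)      = ⊤

zero-or-nonzero : ∀ a → a ≡ fin 0 ⊎ Nonzero a
zero-or-nonzero (fin zero)    = inj₁ refl
zero-or-nonzero (fin (suc _)) = inj₂ tt
zero-or-nonzero (ep _ _)      = inj₂ tt

Nonzero⇒≢0 : ∀ {a} → Nonzero a → ¬ a ≡ fin 0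
Nonzero⇒≢0 {fin zero} () _

≢0⇒0< : ∀ a → ¬ a ≡ fin 0 → fin 0 <ₒ a
≢0⇒0< (fin zero)    ne = ⊥-elim (ne refl)
≢0⇒0< (fin (suc m)) ne = refl
≢0⇒0< (ep _ _)      ne = refl

>⇒Nonzero : ∀ a b → b <ₒ a → Nonzero a
>⇒Nonzero (fin zero)    b p = ⊥-elim (≮0 b p)
>⇒Nonzero (fin (suc _)) b _ = tt
>⇒Nonzero (ep _ _)      b _ = tt

>⇒≢0 : ∀ a b → b <ₒ a → ¬ a ≡ fin 0
>⇒≢0 a b p = Nonzero⇒≢0 (>⇒Nonzero a b p)

Nonzero-tow : ∀ j m → Nonzero (tow j m)
Nonzero-tow j zero    = tt
Nonzero-tow j (suc m) = tt

baseFS-≢0 : ∀ k m → 0 < m → ¬ baseFS k m ≡ fin 0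
baseFS-≢0 zero    (suc m) _ ()
baseFS-≢0 (suc j) m       _ = Nonzero⇒≢0 (Nonzero-tow j m)

-- Term lists: concatenation, and prefixes whose exponents are all nonzero
-- (such a prefix can be continued by any terms without norm collapsing
-- the notation to its coefficient).

infixr 5 _++ₜ_
_++ₜ_ : Terms → Terms → Terms
[]             ++ₜ U = U
(⟨ a , x ⟩∷ T) ++ₜ U = ⟨ a , x ⟩∷ (T ++ₜ U)

++ₜ-identityʳ : ∀ T → T ++ₜ [] ≡ T
++ₜ-identityʳ []             = refl
++ₜ-identityʳ (⟨ a , x ⟩∷ T) = cong (⟨ a , x ⟩∷_) (++ₜ-identityʳ T)

++ₜ-assoc : ∀ T U V → (T ++ₜ U) ++ₜ V ≡ T ++ₜ (U ++ₜ V)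
++ₜ-assoc []             U V = refl
++ₜ-assoc (⟨ a , x ⟩∷ T) U V = cong (⟨ a , x ⟩∷_) (++ₜ-assoc T U V)

NonzeroExps : Terms → Set
NonzeroExps []             = ⊤
NonzeroExps (⟨ a , x ⟩∷ T) = Nonzero a × NonzeroExps T

NonzeroExps-++ : ∀ P Q → NonzeroExps P → NonzeroExps Q → NonzeroExps (P ++ₜ Q)
NonzeroExps-++ []             Q _        q = q
NonzeroExps-++ (⟨ a , x ⟩∷ P) Q (na , p) q = na , NonzeroExps-++ P Q p q

norm-cons : ∀ k a x T → Nonzero a → norm k (⟨ a , x ⟩∷ T) ≡ ep k (⟨ a , x ⟩∷ T)
norm-cons k (fin (suc _)) x T _ = refl
norm-cons k (ep _ _)      x T _ = refl

norm-ep : ∀ k V → FirstExpPos V → norm k V ≡ ep k V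
norm-ep k (⟨ a , x ⟩∷ V) pos = norm-cons k a x V (>⇒Nonzero a (fin 0) pos)

consNZ-cases : ∀ a x T → (x ≡ fin 0 × consNZ a x T ≡ T)
                       ⊎ (consNZ a x T ≡ (⟨ a , x ⟩∷ T) × ¬ x ≡ fin 0)
consNZ-cases a (fin zero)    T = inj₁ (refl , refl)
consNZ-cases a (fin (suc m)) T = inj₂ (refl , λ ())
consNZ-cases a (ep _ _)      T = inj₂ (refl , λ ())

consNZ-≢0 : ∀ a x T → ¬ x ≡ fin 0 → consNZ a x T ≡ (⟨ a , x ⟩∷ T)
consNZ-≢0 a (fin zero)    T ne = ⊥-elim (ne refl)
consNZ-≢0 a (fin (suc m)) T ne = refl
consNZ-≢0 a (ep _ _)      T ne = refl

consNZ-++ : ∀ a x E → consNZ a x E ≡ consNZ a x [] ++ₜ E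
consNZ-++ a (fin zero)    E = refl
consNZ-++ a (fin (suc m)) E = refl
consNZ-++ a (ep _ _)      E = refl

NonzeroExps-consNZ : ∀ a x → Nonzero a → NonzeroExps (consNZ a x [])
NonzeroExps-consNZ a (fin zero)    na = tt
NonzeroExps-consNZ a (fin (suc _)) na = na , tt
NonzeroExps-consNZ a (ep _ _)      na = na , tt

powCoeff : ℕ → Ord → ℕ → Ord
powCoeff k ψ m = if isSucc ψ then baseFS k m else fin 1

powCoeff-≢0 : ∀ k ψ m → 0 < m → ¬ powCoeff k ψ m ≡ fin 0
powCoeff-≢0 k ψ m 0<m with isSucc ψ
... | true  = baseFS-≢0 k m 0<m
... | false = λ ()

powFS-single : ∀ k ψ m → 0 < m → powFS k ψ m ≡ ⟨ ψ [ m ] , powCoeff k ψ m ⟩∷ []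
powFS-single k ψ m 0<m with isSucc ψ
... | true  = consNZ-≢0 (ψ [ m ]) (baseFS k m) [] (baseFS-≢0 k m 0<m)
... | false = refl

succTail : ℕ → Ord → Ord → ℕ → Terms
succTail k ψ ξ m = if isSucc ξ then powFS k ψ m else []

lastFS-nonzero : ∀ k ψ ξ m → Nonzero ψ →
                 lastFS k ψ ξ m ≡ consNZ ψ (ξ [ m ]) (succTail k ψ ξ m)
lastFS-nonzero k (fin (suc _)) ξ m _ with isSucc ξ
... | true  = refl
... | false = refl
lastFS-nonzero k (ep _ _)      ξ m _ with isSucc ξ
... | true  = refl
... | false = refl

fsT-snoc : ∀ k P ψ ξ m → fsT k (P ++ₜ (⟨ ψ , ξ ⟩∷ [])) m ≡ P ++ₜ lastFS k ψ ξ m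
fsT-snoc k []                          ψ ξ m = refl
fsT-snoc k (⟨ a , x ⟩∷ [])             ψ ξ m = refl
fsT-snoc k (⟨ a , x ⟩∷ (⟨ b , y ⟩∷ P)) ψ ξ m =
  cong (⟨ a , x ⟩∷_) (fsT-snoc k (⟨ b , y ⟩∷ P) ψ ξ m)

fs-snoc : ∀ k P ψ ξ m → NonzeroExps P →
          norm k (P ++ₜ (⟨ ψ , ξ ⟩∷ [])) [ m ] ≡ norm k (P ++ₜ lastFS k ψ ξ m)
fs-snoc k [] (fin zero) ξ m _ with ξ [ m ]
... | fin zero    = refl
... | fin (suc _) = refl
... | ep _ _      = refl
fs-snoc k [] (fin (suc _)) ξ m _ = refl
fs-snoc k [] (ep _ _)      ξ m _ = refl
fs-snoc k (⟨ a , x ⟩∷ P) ψ ξ m (na , _)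
  rewrite norm-cons k a x (P ++ₜ (⟨ ψ , ξ ⟩∷ [])) na
        | fsT-snoc k (⟨ a , x ⟩∷ P) ψ ξ m = refl

Below-mono : ∀ {k j} x → Below k x → k ≤ j → Below j x
Below-mono (fin _)   _ _ = tt
Below-mono (ep _ _)  p q = <-≤-trans p q

Below-tow : ∀ j m → Below (suc j) (tow j m)
Below-tow j zero    = tt
Below-tow j (suc m) = ≤-refl

WF-tow : ∀ j m → WF (tow j m)
WF-tow j zero    = tt
WF-tow j (suc m) =
  ≢0⇒0< (tow j m) (Nonzero⇒≢0 (Nonzero-tow j m)) ,
  (WF-tow j m , tt , Below-tow j m , tt , (λ ()) , tt , tt)

WF-baseFS : ∀ k m → WF (baseFS k m)
WF-baseFS zero    m = tt
WF-baseFS (suc j) m = WF-tow j m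

Below-baseFS : ∀ k m → Below k (baseFS k m)
Below-baseFS zero    m = tt
Below-baseFS (suc j) m = Below-tow j m

WF-powCoeff : ∀ k ψ m → WF (powCoeff k ψ m)
WF-powCoeff k ψ m with isSucc ψ
... | true  = WF-baseFS k m
... | false = tt

Below-powCoeff : ∀ k ψ m → Below k (powCoeff k ψ m)
Below-powCoeff k ψ m with isSucc ψ
... | true  = Below-baseFS k m
... | false = tt

data NormView (k : ℕ) : Terms → Set where
  empty : NormView k []
  coeff : ∀ x → Below k x → ¬ x ≡ fin 0 → NormView k (⟨ fin 0 , x ⟩∷ [])
  power : ∀ a x U → Nonzero a → NormView k (⟨ a , x ⟩∷ U)

normView : ∀ k U → WFT k U → NormView k U
normView k [] _ = empty
normView k (⟨ a , x ⟩∷ U) (_ , _ , _ , bx , x≢0 , c<a , _) with zero-or-nonzero a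
... | inj₂ na   = power a x U na
... | inj₁ refl with U
...   | []             = coeff x bx x≢0
...   | ⟨ c , _ ⟩∷ _    = ⊥-elim (≮0 c c<a)

WF-norm : ∀ k U → WFT k U → WF (norm k U)
WF-norm k U wU with normView k U wU
... | empty          = tt
... | coeff x _ _    = proj₁ (proj₂ wU)
... | power a x U' na rewrite norm-cons k a x U' na = ≢0⇒0< a (Nonzero⇒≢0 na) , wU

Below-norm : ∀ k j U → WFT k U → k < j → Below j (norm k U)
Below-norm k j U wU k<j with normView k U wU
... | empty           = tt
... | coeff x bx _    = Below-mono x bx (<⇒≤ k<j)
... | power a x U' na rewrite norm-cons k a x U' na = k<j

cmp-≢0-0 : ∀ x → ¬ x ≡ fin 0 → cmp x (fin 0) ≡ GT
cmp-≢0-0 (fin zero)    ne = ⊥-elim (ne refl)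
cmp-≢0-0 (fin (suc _)) _  = refl
cmp-≢0-0 (ep _ _)      _  = refl

cmp-Below-ep : ∀ {k} y W → Below k y → cmp y (ep k W) ≡ LT
cmp-Below-ep (fin _)   W _ = refl
cmp-Below-ep (ep _ _)  W p = lex-LT (cmpℕ-< p)

cmp-ep-Below : ∀ {k} y W → Below k y → cmp (ep k W) y ≡ GT
cmp-ep-Below (fin _)    W _ = refl
cmp-ep-Below (ep k' _)  W p rewrite cmpℕ-> p = refl

norm-cmp : ∀ k U V → WFT k U → WFT k V → cmp (norm k U) (norm k V) ≡ cmpT U V
norm-cmp k U V wU wV = go (normView k U wU) (normView k V wV)
  where
  go : ∀ {U V} → NormView k U → NormView k V → cmp (norm k U) (norm k V) ≡ cmpT U V
  go empty              empty              = refl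
  go empty              (coeff y _ y≢0)    = ≢0⇒0< y y≢0
  go empty              (power b y V nb)   rewrite norm-cons k b y V nb = refl
  go (coeff x _ x≢0)    empty              = cmp-≢0-0 x x≢0
  go (coeff x _ _)      (coeff y _ _)      = sym (lex-EQʳ (cmp x y))
  go (coeff x bx _)     (power b y V nb)
    rewrite norm-cons k b y V nb | ≢0⇒0< b (Nonzero⇒≢0 nb) = cmp-Below-ep x _ bx
  go (power a x U na)   empty              rewrite norm-cons k a x U na = refl
  go (power a x U na)   (coeff y by _)
    rewrite norm-cons k a x U na | cmp-≢0-0 a (Nonzero⇒≢0 na) = cmp-ep-Below y _ by
  go (power a x U na)   (power b y V nb)
    rewrite norm-cons k a x U na | norm-cons k b y V nb | cmpℕ-refl k = refl

FirstExpBelow-trans : ∀ T {a c} → FirstExpBelow T a → a <ₒ c → FirstExpBelow T c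
FirstExpBelow-trans []             _ _ = tt
FirstExpBelow-trans (⟨ b , _ ⟩∷ _) {a} {c} p q = <ₒ-trans {b} {a} {c} p q

FirstExpBelow-cmp : ∀ T ψ ξ U → FirstExpBelow T ψ → cmpT T (⟨ ψ , ξ ⟩∷ U) ≡ LT
FirstExpBelow-cmp []             ψ ξ U _ = refl
FirstExpBelow-cmp (⟨ b , _ ⟩∷ _) ψ ξ U p = lex-LT p

lex-LT-nil : ∀ c U → lex c (cmpT U []) ≡ LT → c ≡ LT
lex-LT-nil LT U             _ = refl
lex-LT-nil EQ []            ()
lex-LT-nil EQ (⟨ _ , _ ⟩∷ _) ()

iterFS-+ : ∀ n i j β → iterFS n (i + j) β ≡ iterFS n j (iterFS n i β)
iterFS-+ n zero    j β = refl
iterFS-+ n (suc i) j β = iterFS-+ n i j (β [ n ])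

⇒-trans : ∀ {n a b c} → a ⇒[ n ] b → b ⇒[ n ] c → a ⇒[ n ] c
⇒-trans {n} {a} (i , p) (j , q) =
  i + j , trans (iterFS-+ n i j a) (trans (cong (iterFS n j) p) q)

⇒-step : ∀ {n a b c} → a [ n ] ≡ b → b ⇒[ n ] c → a ⇒[ n ] c
⇒-step refl (i , p) = suc i , p

⇒-≡ : ∀ {n a b} → a ≡ b → a ⇒[ n ] b
⇒-≡ p = 0 , p

fin⇒0 : ∀ n m → fin m ⇒[ n ] fin 0
fin⇒0 n m = m , go m
  where
  go : ∀ m → iterFS n m (fin m) ≡ fin 0
  go zero    = refl
  go (suc m) = go m

-- Termination: for n > 0 every well-formed notation reaches 0.  The
-- fundamental sequence only changes the last term ε^ψ·ξ of a normal form;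
-- by induction on the number of steps ψ and ξ need to reach 0, the whole
-- term is stepped away, leaving the prefix in front of it.

module Termination (n : ℕ) (0<n : 0 < n) where

  ZeroAfter : Ord → ℕ → Set
  ZeroAfter β i = iterFS n i β ≡ fin 0

  dropConsNZ : ∀ k P a x → (¬ x ≡ fin 0 → norm k (P ++ₜ (⟨ a , x ⟩∷ [])) ⇒[ n ] norm k P) →
               norm k (P ++ₜ consNZ a x []) ⇒[ n ] norm k P
  dropConsNZ k P a x drop with consNZ-cases a x []
  ... | inj₁ (_ , e)  rewrite e = ⇒-≡ (cong (norm k) (++ₜ-identityʳ P))
  ... | inj₂ (e , ne) rewrite e = drop ne

  -- A final term ε^0·ξ only decreases ξ.
  dropCoeffTerm : ∀ k ξ j → ZeroAfter ξ j → ∀ P → NonzeroExps P →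
               norm k (P ++ₜ (⟨ fin 0 , ξ ⟩∷ [])) ⇒[ n ] norm k P
  dropCoeffTerm k ξ zero refl P nz =
    ⇒-step (fs-snoc k P (fin 0) (fin 0) n nz) (⇒-≡ (cong (norm k) (++ₜ-identityʳ P)))
  dropCoeffTerm k ξ (suc j) rξ P nz = ⇒-step (fs-snoc k P (fin 0) ξ n nz)
    (dropConsNZ k P (fin 0) (ξ [ n ]) (λ _ → dropCoeffTerm k (ξ [ n ]) j rξ P nz))

  -- The base sequence ε_{k-1}[n], and with it the coefficient of every
  -- (ε^ψ)[n], reaches 0; this is proved below, together with the towers.
  BaseReachesZero : ℕ → Set
  BaseReachesZero k = baseFS k n ⇒[ n ] fin 0

  powCoeff⇒0 : ∀ k → BaseReachesZero k → ∀ ψ → powCoeff k ψ n ⇒[ n ] fin 0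
  powCoeff⇒0 k hb ψ with isSucc ψ
  ... | true  = hb
  ... | false = fin⇒0 n 1

  mutual
    dropTerm : ∀ k → BaseReachesZero k → ∀ ψ i → ZeroAfter ψ i → ∀ ξ j → ZeroAfter ξ j →
               ∀ P → NonzeroExps P → norm k (P ++ₜ (⟨ ψ , ξ ⟩∷ [])) ⇒[ n ] norm k P
    dropTerm k hb ψ i rψ ξ j rξ P nz with zero-or-nonzero ψ
    ... | inj₁ refl = dropCoeffTerm k ξ j rξ P nz
    ... | inj₂ nψ   = dropPosTerm k hb ψ nψ i rψ ξ j rξ P nz

    -- For ψ > 0, induction on the steps of ξ: each step replaces ξ by ξ[n]
    -- and possibly appends (ε^ψ)[n], which is dropped first.
    dropPosTerm : ∀ k → BaseReachesZero k → ∀ ψ → Nonzero ψ → ∀ i → ZeroAfter ψ i →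
                  ∀ ξ j → ZeroAfter ξ j → ∀ P → NonzeroExps P →
                  norm k (P ++ₜ (⟨ ψ , ξ ⟩∷ [])) ⇒[ n ] norm k P
    dropPosTerm k hb ψ nψ i rψ ξ zero refl P nz =
      ⇒-step (trans (fs-snoc k P ψ (fin 0) n nz)
                    (cong (λ L → norm k (P ++ₜ L)) (lastFS-nonzero k ψ (fin 0) n nψ)))
             (⇒-≡ (cong (norm k) (++ₜ-identityʳ P)))
    dropPosTerm k hb ψ nψ i rψ ξ (suc j) rξ P nz =
      ⇒-step (trans (fs-snoc k P ψ ξ n nz)
                    (cong (λ L → norm k (P ++ₜ L)) (lastFS-nonzero k ψ ξ n nψ)))
             (⇒-trans (dropSuccTail k hb ψ nψ i rψ ξ P nz)
                      (dropConsNZ k P ψ (ξ [ n ])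
                         (λ _ → dropPosTerm k hb ψ nψ i rψ (ξ [ n ]) j rξ P nz)))

    dropSuccTail : ∀ k → BaseReachesZero k → ∀ ψ → Nonzero ψ → ∀ i → ZeroAfter ψ i →
                   ∀ ξ P → NonzeroExps P →
                   norm k (P ++ₜ consNZ ψ (ξ [ n ]) (succTail k ψ ξ n))
                     ⇒[ n ] norm k (P ++ₜ consNZ ψ (ξ [ n ]) [])
    dropSuccTail k hb ψ nψ i rψ ξ P nz
      rewrite consNZ-++ ψ (ξ [ n ]) (succTail k ψ ξ n)
            | sym (++ₜ-assoc P (consNZ ψ (ξ [ n ]) []) (succTail k ψ ξ n)) with isSucc ξ
    ... | true  = dropPower k hb ψ nψ i rψ (P ++ₜ consNZ ψ (ξ [ n ]) [])
                    (NonzeroExps-++ P _ nz (NonzeroExps-consNZ ψ (ξ [ n ]) nψ))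
    ... | false = ⇒-≡ (cong (norm k) (++ₜ-identityʳ (P ++ₜ consNZ ψ (ξ [ n ]) [])))

    -- (ε^ψ)[n] = ε^{ψ[n]}·c is dropped using the induction on ψ.
    dropPower : ∀ k → BaseReachesZero k → ∀ ψ → Nonzero ψ → ∀ i → ZeroAfter ψ i →
                ∀ Q → NonzeroExps Q → norm k (Q ++ₜ powFS k ψ n) ⇒[ n ] norm k Q
    dropPower k hb ψ nψ zero    rψ Q nz = ⊥-elim (Nonzero⇒≢0 nψ rψ)
    dropPower k hb ψ nψ (suc i) rψ Q nz rewrite powFS-single k ψ n 0<n =
      dropTerm k hb (ψ [ n ]) i rψ (powCoeff k ψ n) (proj₁ c⇒0) (proj₂ c⇒0) Q nz
      where
      c⇒0 : powCoeff k ψ n ⇒[ n ] fin 0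
      c⇒0 = powCoeff⇒0 k hb ψ

  mutual
    base⇒0 : ∀ k → BaseReachesZero k
    base⇒0 zero    = fin⇒0 n n
    base⇒0 (suc j) = tow⇒0 j n

    -- tow_{m+1}(ε_{j-1}) is the single term ε_{j-1}^{tow_m}·1.
    tow⇒0 : ∀ j m → tow j m ⇒[ n ] fin 0
    tow⇒0 j zero    = fin⇒0 n 1
    tow⇒0 j (suc m) =
      subst (_⇒[ n ] fin 0) (norm-cons j (tow j m) (fin 1) [] (Nonzero-tow j m))
        (dropTerm j (base⇒0 j) (tow j m) (proj₁ (tow⇒0 j m)) (proj₂ (tow⇒0 j m))
                  (fin 1) 1 refl [] tt)

  mutual
    reachesZero : ∀ β → WF β → β ⇒[ n ] fin 0
    reachesZero (fin m) _ = fin⇒0 n m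
    reachesZero (ep k (⟨ a , x ⟩∷ T)) (pos , wT) =
      subst (_⇒[ n ] fin 0) (norm-ep k (⟨ a , x ⟩∷ T) pos)
        (dropTerms k (⟨ a , x ⟩∷ T) wT [] tt)

    -- The terms of a normal form are stepped away from the last one on.
    dropTerms : ∀ k T → WFT k T → ∀ P → NonzeroExps P → norm k (P ++ₜ T) ⇒[ n ] norm k P
    dropTerms k [] _ P nz = ⇒-≡ (cong (norm k) (++ₜ-identityʳ P))
    dropTerms k (⟨ a , x ⟩∷ []) (wa , wx , _) P nz = dropWFTerm k a x wa wx P nz
    dropTerms k (⟨ a , x ⟩∷ (⟨ b , y ⟩∷ T)) (wa , wx , _ , _ , _ , b<a , wT) P nz =
      subst (λ Q → norm k Q ⇒[ n ] norm k P) (++ₜ-assoc P (⟨ a , x ⟩∷ []) (⟨ b , y ⟩∷ T))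
        (⇒-trans (dropTerms k (⟨ b , y ⟩∷ T) wT (P ++ₜ (⟨ a , x ⟩∷ []))
                    (NonzeroExps-++ P _ nz (>⇒Nonzero a b b<a , tt)))
                 (dropWFTerm k a x wa wx P nz))

    dropWFTerm : ∀ k a x → WF a → WF x → ∀ P → NonzeroExps P →
                 norm k (P ++ₜ (⟨ a , x ⟩∷ [])) ⇒[ n ] norm k P
    dropWFTerm k a x wa wx =
      dropTerm k (base⇒0 k) a (proj₁ (reachesZero a wa)) (proj₂ (reachesZero a wa))
                            x (proj₁ (reachesZero x wx)) (proj₂ (reachesZero x wx))

module Descent (n : ℕ) (0<n : 0 < n) where

  Descends : Ord → Set
  Descends γ = WF (γ [ n ]) × (∀ j → Below j γ → Below j (γ [ n ]))
             × (¬ γ ≡ fin 0 → (γ [ n ]) <ₒ γ)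

  Replaces : ℕ → Terms → Terms → Set
  Replaces k L T = WFT k L × cmpT L T ≡ LT
                 × (∀ c → FirstExpBelow T c → FirstExpBelow L c)

  consNZ-replaces : ∀ k ψ ξ T → WF ψ → Below (suc k) ψ → Below k ξ → ¬ ξ ≡ fin 0 →
                    Descends ξ → WFT k T → FirstExpBelow T ψ →
                    Replaces k (consNZ ψ (ξ [ n ]) T) (⟨ ψ , ξ ⟩∷ [])
  consNZ-replaces k ψ ξ T wψ bψ bξ ξ≢0 (wξ' , bξ' , ξ'<ξ) wT T<ψ
    with consNZ-cases ψ (ξ [ n ]) T
  ... | inj₁ (_ , e) rewrite e =
        wT , FirstExpBelow-cmp T ψ ξ [] T<ψ , (λ c ψ<c → FirstExpBelow-trans T T<ψ ψ<c)
  ... | inj₂ (e , ξ'≢0) rewrite e | cmp-refl ψ =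
        (wψ , wξ' , bψ , bξ' k bξ , ξ'≢0 , T<ψ , wT) , lex-LT (ξ'<ξ ξ≢0) , (λ c ψ<c → ψ<c)

  succTail-WFT : ∀ k ψ ξ → Below (suc k) ψ → Nonzero ψ → Descends ψ →
                 WFT k (succTail k ψ ξ n) × FirstExpBelow (succTail k ψ ξ n) ψ
  succTail-WFT k ψ ξ bψ nψ (wψ' , bψ' , ψ'<ψ) with isSucc ξ
  ... | false = tt , tt
  ... | true rewrite powFS-single k ψ n 0<n =
        (wψ' , WF-powCoeff k ψ n , bψ' (suc k) bψ , Below-powCoeff k ψ n ,
         powCoeff-≢0 k ψ n 0<n , tt , tt) ,
        ψ'<ψ (Nonzero⇒≢0 nψ)

  mutual
    descends : ∀ γ → WF γ → Descends γ
    descends (fin zero)    _ = tt , (λ _ _ → tt) , (λ ne → ⊥-elim (ne refl))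
    descends (fin (suc m)) _ = tt , (λ _ _ → tt) , (λ _ → cmpℕ-< (n<1+n m))
    descends (ep k (⟨ a , x ⟩∷ T)) (pos , wT) with replaces k a x T wT
    ... | wL , L<T , _ =
      WF-norm k _ wL , (λ j k<j → Below-norm k j _ wL k<j) ,
      (λ _ → subst (λ z → cmp (norm k (fsT k (⟨ a , x ⟩∷ T) n)) z ≡ LT)
                   (norm-ep k (⟨ a , x ⟩∷ T) pos)
                   (trans (norm-cmp k _ _ wL wT) L<T))

    replaces : ∀ k a x T → WFT k (⟨ a , x ⟩∷ T) →
               Replaces k (fsT k (⟨ a , x ⟩∷ T) n) (⟨ a , x ⟩∷ T)
    replaces k ψ ξ [] (wψ , wξ , bψ , bξ , ξ≢0 , _) = replacesLast k ψ ξ wψ wξ bψ bξ ξ≢0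
    replaces k a x (⟨ b , y ⟩∷ T) (wa , wx , ba , bx , x≢0 , b<a , wT)
      with replaces k b y T wT
    ... | wL , L<T , firstExp rewrite cmp-refl a | cmp-refl x =
      (wa , wx , ba , bx , x≢0 , firstExp a b<a , wL) , L<T , (λ c a<c → a<c)

    replacesLast : ∀ k ψ ξ → WF ψ → WF ξ → Below (suc k) ψ → Below k ξ → ¬ ξ ≡ fin 0 →
                   Replaces k (lastFS k ψ ξ n) (⟨ ψ , ξ ⟩∷ [])
    replacesLast k ψ ξ wψ wξ bψ bξ ξ≢0 with zero-or-nonzero ψ
    ... | inj₁ refl = consNZ-replaces k ψ ξ [] wψ bψ bξ ξ≢0 (descends ξ wξ) tt tt
    ... | inj₂ nψ rewrite lastFS-nonzero k ψ ξ n nψ =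
      consNZ-replaces k ψ ξ (succTail k ψ ξ n) wψ bψ bξ ξ≢0 (descends ξ wξ)
        (proj₁ tail) (proj₂ tail)
      where
      tail : WFT k (succTail k ψ ξ n) × FirstExpBelow (succTail k ψ ξ n) ψ
      tail = succTail-WFT k ψ ξ bψ nψ (descends ψ wψ)

tow-step : ∀ j m → tow j m <ₒ tow j (suc m)
tow-step j zero    = refl
tow-step j (suc m) rewrite cmpℕ-refl j | tow-step j m = refl

tow-mono : ∀ j h m → h < m → tow j h <ₒ tow j m
tow-mono j h (suc m) h<1+m with m<1+n⇒m<n∨m≡n h<1+m
... | inj₁ h<m  = <ₒ-trans {tow j h} {tow j m} {tow j (suc m)} (tow-mono j h m h<m) (tow-step j m)
... | inj₂ refl = tow-step j h

Below-tow-< : ∀ j y m → Below j y → 0 < m → y <ₒ tow j m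
Below-tow-< j (fin a)   (suc m) _    _ = refl
Below-tow-< j (ep k' U) (suc m) k'<j _ = lex-LT (cmpℕ-< k'<j)

-- Pseudonorm bounds: an ordinal below ε_{k-1} whose pseudonorm is below n
-- already lies below ε_{k-1}[n].  This is where the hypothesis psn(α) < n
-- enters the proof.

module PsnBound (n : ℕ) (0<n : 0 < n) where

  PsnBelow : Ord → Set
  PsnBelow α = ∃ λ p → Psn α p × p < n

  PsnBelowT : Terms → Set
  PsnBelowT []             = ⊤
  PsnBelowT (⟨ a , x ⟩∷ U) = PsnBelow a × PsnBelow x × PsnBelowT U

  PsnBelow-0 : PsnBelow (fin 0)
  PsnBelow-0 = 0 , psn-fin , 0<n

  PsnT⇒PsnBelowT : ∀ {U q} → PsnT U q → q < n → PsnBelowT U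
  PsnT⇒PsnBelowT psnT-[] _ = tt
  PsnT⇒PsnBelowT (psnT-∷ {pa = pa} {px = px} {pt = pt} sa sx st) q<n =
    (pa , sa , m⊔n<o⇒m<o pa _ q<n) ,
    (px , sx , m⊔n<o⇒m<o px pt (m⊔n<o⇒n<o pa _ q<n)) ,
    PsnT⇒PsnBelowT st (m⊔n<o⇒n<o px pt (m⊔n<o⇒n<o pa _ q<n))

  below-baseFS : ∀ k x → Below k x → PsnBelow x → x <ₒ baseFS k n
  below-baseFS zero    (fin a)    _ (_ , psn-fin , a<n) = cmpℕ-< a<n
  below-baseFS (suc j) (fin a) _ _ = Below-tow-< j (fin a) n tt 0<n
  below-baseFS (suc j) (ep k' U) k'<1+j (_ , psn-ep {h = h} {q = q} isH _ , h⊔q<n)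
    with m<1+n⇒m<n∨m≡n k'<1+j
  ... | inj₁ k'<j = Below-tow-< j (ep k' U) n k'<j 0<n
  ... | inj₂ refl =
    <ₒ-trans {ep k' U} {tow k' h} {tow k' n} (proj₁ isH) (tow-mono k' h n (m⊔n<o⇒m<o h q h⊔q<n))

-- Proved by induction on γ, via the term list of
-- its normal form; α is first written over the same base as γ.

module StepBound (n : ℕ) (0<n : 0 < n) where
  open PsnBound n 0<n
  open Descent n 0<n using (replaces)

  AtMostFS : Ord → Ord → Set
  AtMostFS α γ = α <ₒ (γ [ n ]) ⊎ (α ≡ (γ [ n ]) × isSucc γ ≡ true)

  AtMostFST : Terms → Terms → Bool → Set
  AtMostFST U L s = cmpT U L ≡ LT ⊎ (U ≡ L × s ≡ true)

  Bounded : Ord → Set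
  Bounded γ = ∀ α → WF α → PsnBelow α → α <ₒ γ → AtMostFS α γ

  fs≡0⇒succ : ∀ ξ → Bounded ξ → ¬ ξ ≡ fin 0 → ξ [ n ] ≡ fin 0 → isSucc ξ ≡ true
  fs≡0⇒succ ξ bξ ξ≢0 ξ'≡0 with bξ (fin 0) tt PsnBelow-0 (≢0⇒0< ξ ξ≢0)
  ... | inj₁ 0<ξ'    = ⊥-elim (>⇒≢0 (ξ [ n ]) (fin 0) 0<ξ' ξ'≡0)
  ... | inj₂ (_ , s) = s

  -- Lists with first exponent below ψ stay below (ε^ψ)[n] = ε^{ψ[n]}·c:
  -- the exponent can only reach ψ[n] if ψ is a successor, and then the
  -- coefficient c = ε_{k-1}[n] exceeds every coefficient of psn < n.
  below-powFS : ∀ k ψ → Bounded ψ → ∀ U → WFT k U → PsnBelowT U → FirstExpBelow U ψ →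
                cmpT U (powFS k ψ n) ≡ LT
  below-powFS k ψ bψ [] _ _ _ rewrite powFS-single k ψ n 0<n = refl
  below-powFS k ψ bψ (⟨ c , z ⟩∷ U) (wc , _ , _ , bz , _) (pc , pz , _) c<ψ
    rewrite powFS-single k ψ n 0<n with bψ c wc pc c<ψ
  ... | inj₁ c<ψ'           = lex-LT c<ψ'
  ... | inj₂ (c≡ψ' , succ) with isSucc ψ
  ...   | true = trans (lex-EQ (cmp-≡ c≡ψ')) (lex-LT (below-baseFS k z bz pz))

  below-succTail : ∀ k ψ ξ → Bounded ψ → isSucc ξ ≡ true →
                   ∀ U → WFT k U → PsnBelowT U → FirstExpBelow U ψ →
                   cmpT U (succTail k ψ ξ n) ≡ LT
  below-succTail k ψ ξ bψ succ with isSucc ξ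
  ... | true = below-powFS k ψ bψ

  -- Last term ε^0·ξ: (ε^0·ξ)[n] = ε^0·ξ[n], so the bound for ξ transfers.
  lastZero-bound : ∀ k ξ → Bounded ξ → ¬ ξ ≡ fin 0 →
                   ∀ U → WFT k U → PsnBelowT U → cmpT U (⟨ fin 0 , ξ ⟩∷ []) ≡ LT →
                   AtMostFST U (consNZ (fin 0) (ξ [ n ]) []) (isSucc ξ)
  lastZero-bound k ξ bξ ξ≢0 [] _ _ _ with bξ (fin 0) tt PsnBelow-0 (≢0⇒0< ξ ξ≢0)
  ... | inj₁ 0<ξ' rewrite consNZ-≢0 (fin 0) (ξ [ n ]) [] (>⇒≢0 (ξ [ n ]) (fin 0) 0<ξ') = inj₁ refl
  ... | inj₂ (0≡ξ' , succ) rewrite sym 0≡ξ' = inj₂ (refl , succ)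
  lastZero-bound k ξ bξ ξ≢0 (⟨ c , z ⟩∷ U) (_ , wz , _ , _ , z≢0 , U<c , _) (_ , pz , _) lt
    with lex-LT-inv (cmp c (fin 0)) lt
  ... | inj₁ c<0 = ⊥-elim (≮0 c c<0)
  ... | inj₂ (c≡0 , lt') with cmp-EQ {c} c≡0
  ...   | refl with U
  ...     | ⟨ d , _ ⟩∷ _ = ⊥-elim (≮0 d U<c)
  ...     | [] with bξ z wz pz (lex-LT-nil (cmp z ξ) [] lt')
  ...       | inj₁ z<ξ' rewrite consNZ-≢0 (fin 0) (ξ [ n ]) [] (>⇒≢0 (ξ [ n ]) z z<ξ') =
                inj₁ (lex-LT z<ξ')
  ...       | inj₂ (z≡ξ' , succ) rewrite consNZ-≢0 (fin 0) (ξ [ n ]) [] (λ e → z≢0 (trans z≡ξ' e)) =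
                inj₂ (cong (λ w → ⟨ fin 0 , w ⟩∷ []) z≡ξ' , succ)

  -- Last term ε^ψ·ξ with ψ > 0 and ξ[n] = 0: then (ε^ψ·ξ)[n] = (ε^ψ)[n], and
  -- nothing below ε^ψ·ξ can start with ε^ψ.
  dropped-FirstExpBelow : ∀ k ψ ξ → Bounded ξ → ξ [ n ] ≡ fin 0 →
                          ∀ U → WFT k U → PsnBelowT U → cmpT U (⟨ ψ , ξ ⟩∷ []) ≡ LT →
                          FirstExpBelow U ψ
  dropped-FirstExpBelow k ψ ξ bξ ξ'≡0 [] _ _ _ = tt
  dropped-FirstExpBelow k ψ ξ bξ ξ'≡0 (⟨ c , z ⟩∷ U) (_ , wz , _ , _ , z≢0 , _) (_ , pz , _) lt
    with lex-LT-inv (cmp c ψ) lt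
  ... | inj₁ c<ψ       = c<ψ
  ... | inj₂ (_ , lt') with bξ z wz pz (lex-LT-nil (cmp z ξ) U lt')
  ...   | inj₁ z<ξ'      = ⊥-elim (≮0 z (subst (z <ₒ_) ξ'≡0 z<ξ'))
  ...   | inj₂ (z≡ξ' , _) = ⊥-elim (z≢0 (trans z≡ξ' ξ'≡0))

  -- A list equal to ε^ψ·ξ[n] at the head can only arise
  -- when ξ is a successor, and then its rest is below (ε^ψ)[n].
  kept-bound : ∀ k ψ ξ → Bounded ψ → Bounded ξ →
               ∀ U → WFT k U → PsnBelowT U → cmpT U (⟨ ψ , ξ ⟩∷ []) ≡ LT →
               cmpT U (⟨ ψ , ξ [ n ] ⟩∷ succTail k ψ ξ n) ≡ LT
  kept-bound k ψ ξ bψ bξ [] _ _ _ = refl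
  kept-bound k ψ ξ bψ bξ (⟨ c , z ⟩∷ U) (_ , wz , _ , _ , _ , U<c , wU) (_ , pz , pU) lt
    with lex-LT-inv (cmp c ψ) lt
  ... | inj₁ c<ψ        = lex-LT c<ψ
  ... | inj₂ (c≡ψ , lt') with bξ z wz pz (lex-LT-nil (cmp z ξ) U lt')
  ...   | inj₁ z<ξ'        = trans (lex-EQ c≡ψ) (lex-LT z<ξ')
  ...   | inj₂ (z≡ξ' , succ) =
    trans (lex-EQ c≡ψ) (trans (lex-EQ (cmp-≡ z≡ξ'))
      (below-succTail k ψ ξ bψ succ U wU pU (subst (FirstExpBelow U) (cmp-EQ c≡ψ) U<c)))

  lastPos-bound : ∀ k ψ ξ → Nonzero ψ → Bounded ψ → Bounded ξ → ¬ ξ ≡ fin 0 →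
                  ∀ U → WFT k U → PsnBelowT U → cmpT U (⟨ ψ , ξ ⟩∷ []) ≡ LT →
                  cmpT U (lastFS k ψ ξ n) ≡ LT
  lastPos-bound k ψ ξ nψ bψ bξ ξ≢0 U wU pU lt
    rewrite lastFS-nonzero k ψ ξ n nψ with consNZ-cases ψ (ξ [ n ]) (succTail k ψ ξ n)
  ... | inj₁ (ξ'≡0 , e) rewrite e =
    below-succTail k ψ ξ bψ (fs≡0⇒succ ξ bξ ξ≢0 ξ'≡0) U wU pU
      (dropped-FirstExpBelow k ψ ξ bξ ξ'≡0 U wU pU lt)
  ... | inj₂ (e , _) rewrite e = kept-bound k ψ ξ bψ bξ U wU pU lt

  lastTerm-bound : ∀ k ψ ξ → Bounded ψ → Bounded ξ → ¬ ξ ≡ fin 0 →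
                   ∀ U → WFT k U → PsnBelowT U → cmpT U (⟨ ψ , ξ ⟩∷ []) ≡ LT →
                   AtMostFST U (lastFS k ψ ξ n) (isSuccT (⟨ ψ , ξ ⟩∷ []))
  lastTerm-bound k ψ ξ bψ bξ ξ≢0 U wU pU lt with zero-or-nonzero ψ
  ... | inj₁ refl = lastZero-bound k ξ bξ ξ≢0 U wU pU lt
  ... | inj₂ nψ   = inj₁ (lastPos-bound k ψ ξ nψ bψ bξ ξ≢0 U wU pU lt)

  BoundedT : ℕ → Terms → Set
  BoundedT k T = ∀ U → WFT k U → PsnBelowT U → cmpT U T ≡ LT → AtMostFST U (fsT k T n) (isSuccT T)

  isSuccT-cons : ∀ a x b y T → isSuccT (⟨ a , x ⟩∷ (⟨ b , y ⟩∷ T)) ≡ isSuccT (⟨ b , y ⟩∷ T)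
  isSuccT-cons (fin zero)    x b y T = refl
  isSuccT-cons (fin (suc _)) x b y T = refl
  isSuccT-cons (ep _ _)      x b y T = refl

  -- A leading term that is not the last one is kept by the fundamental
  -- sequence, so the bound reduces to the remaining terms.
  boundedCons : ∀ k a x b y T → BoundedT k (⟨ b , y ⟩∷ T) → BoundedT k (⟨ a , x ⟩∷ (⟨ b , y ⟩∷ T))
  boundedCons k a x b y T bT [] _ _ _ = inj₁ refl
  boundedCons k a x b y T bT (⟨ c , z ⟩∷ U) (_ , _ , _ , _ , _ , _ , wU) (_ , _ , pU) lt
    with lex-LT-inv (cmp c a) lt
  ... | inj₁ c<a = inj₁ (lex-LT c<a)
  ... | inj₂ (c≡a , lt') with lex-LT-inv (cmp z x) lt'
  ...   | inj₁ z<x = inj₁ (trans (lex-EQ c≡a) (lex-LT z<x))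
  ...   | inj₂ (z≡x , lt'') with bT U wU pU lt''
  ...     | inj₁ U<L       = inj₁ (trans (lex-EQ c≡a) (trans (lex-EQ z≡x) U<L))
  ...     | inj₂ (U≡L , s) =
    inj₂ (cons-≡ (cmp-EQ c≡a) (cmp-EQ z≡x) U≡L , trans (isSuccT-cons a x b y T) s)

  -- Every α < ep k T is the normalisation of a well-formed list over base k
  -- (of level k itself, or a single coefficient ε^0·α).
  asTerms : ∀ k α T → WF α → PsnBelow α → α <ₒ ep k T →
            ∃ λ U → WFT k U × PsnBelowT U × norm k U ≡ α
  asTerms k (fin zero)    T _ _ _ = [] , tt , tt , refl
  asTerms k (fin (suc m)) T _ pα _ =
    (⟨ fin 0 , fin (suc m) ⟩∷ []) , (tt , tt , tt , tt , (λ ()) , tt , tt) , (PsnBelow-0 , pα , tt) , refl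
  asTerms k (ep k' V) T wα pα lt with lex-LT-inv (cmpℕ k' k) lt
  ... | inj₁ k'<k =
    (⟨ fin 0 , ep k' V ⟩∷ []) , (tt , wα , tt , cmpℕ-LT k'<k , (λ ()) , tt , tt) , (PsnBelow-0 , pα , tt) , refl
  ... | inj₂ (k'≡k , _) with cmpℕ-EQ {k'} {k} k'≡k
  ...   | refl with wα | pα
  ...     | pos , wV | (_ , psn-ep {h = h} {q = q} _ psnV , h⊔q<n) =
    V , wV , PsnT⇒PsnBelowT psnV (m⊔n<o⇒n<o h q h⊔q<n) , norm-ep k V pos

  boundedEp : ∀ k a x T → fin 0 <ₒ a → WFT k (⟨ a , x ⟩∷ T) → BoundedT k (⟨ a , x ⟩∷ T) →
              Bounded (ep k (⟨ a , x ⟩∷ T))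
  boundedEp k a x T pos wT bT α wα pα α<γ with asTerms k α (⟨ a , x ⟩∷ T) wα pα α<γ
  ... | U , wU , pU , refl with bT U wU pU U<T
    where
    U<T : cmpT U (⟨ a , x ⟩∷ T) ≡ LT
    U<T = trans (sym (norm-cmp k U _ wU wT))
                (subst (λ γ → cmp (norm k U) γ ≡ LT) (sym (norm-ep k (⟨ a , x ⟩∷ T) pos)) α<γ)
  ... | inj₁ U<L       = inj₁ (trans (norm-cmp k U _ wU (proj₁ (replaces k a x T wT))) U<L)
  ... | inj₂ (U≡L , s) = inj₂ (cong (norm k) U≡L , s)

  mutual
    bounded : ∀ γ → WF γ → Bounded γ
    bounded (fin zero)    _ α _ _ α<0 = ⊥-elim (≮0 α α<0)
    bounded (fin (suc m)) _ (fin a) _ _ a<1+m with m<1+n⇒m<n∨m≡n (cmpℕ-LT {a} {suc m} a<1+m)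
    ... | inj₁ a<m  = inj₁ (cmpℕ-< a<m)
    ... | inj₂ refl = inj₂ (refl , refl)
    bounded (ep k (⟨ a , x ⟩∷ T)) (pos , wT) =
      boundedEp k a x T pos wT (boundedT k a x T wT)

    boundedT : ∀ k a x T → WFT k (⟨ a , x ⟩∷ T) → BoundedT k (⟨ a , x ⟩∷ T)
    boundedT k ψ ξ [] (wψ , wξ , _ , _ , ξ≢0 , _) =
      lastTerm-bound k ψ ξ (bounded ψ wψ) (bounded ξ wξ) ξ≢0
    boundedT k a x (⟨ b , y ⟩∷ T) (_ , _ , _ , _ , _ , _ , wT) =
      boundedCons k a x b y T (boundedT k b y T wT)

-- Reachability: if γ reaches 0 in i steps, every smaller α of pseudonorm
-- below n is reached; by the step bound α either stays below γ[n] (recurse)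
-- or equals it.

module Reachability (n : ℕ) (0<n : 0 < n) where
  open PsnBound n 0<n using (PsnBelow)
  open Descent n 0<n using (descends)
  open StepBound n 0<n using (bounded)

  reach : ∀ i γ → WF γ → iterFS n i γ ≡ fin 0 →
          ∀ α → WF α → PsnBelow α → α <ₒ γ → γ ⇒[ n ] α
  reach zero    γ _  γ≡0 α _  _  α<γ = ⊥-elim (≮0 α (subst (α <ₒ_) γ≡0 α<γ))
  reach (suc i) γ wγ γ⇒0 α wα pα α<γ with bounded γ wγ α wα pα α<γ
  ... | inj₁ α<γ'        = ⇒-step refl (reach i (γ [ n ]) (proj₁ (descends γ wγ)) γ⇒0 α wα pα α<γ')
  ... | inj₂ (α≡γ' , _) = 1 , sym α≡γ'

mainTheorem6 : (β α : Ord) (n : ℕ) → WF β → WF α → α <ₒ β → 1 < n →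
                 (p : ℕ) → Psn α p → p < n → β ⇒[ n ] α
mainTheorem6 β α n wβ wα α<β 1<n p psnα p<n =
  reach (proj₁ β⇒0) β wβ (proj₂ β⇒0) α wα (p , psnα , p<n) α<β
  where
  0<n : 0 < n
  0<n = <⇒≤ 1<n

  open Termination n 0<n using (reachesZero)
  open Reachability n 0<n using (reach)

  β⇒0 : β ⇒[ n ] fin 0
  β⇒0 = reachesZero β wβ
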